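{- Let $k\ge1$ and let $G$ be a $k$-pseudorandom oriented graph on $n$ vertices. Then $G$ contains a directed path of length $n-2k+1$ (i.e. with $n-2k+1$ edges), whenever $n-2k+1\ge 0$.
   Context: An oriented graph is a directed graph with no loops, no parallel edges and no pair of antiparallel edges. A directed graph $G$ is $k$-pseudorandom if for every two disjoint vertex sets $A,B$ with $|A|,|B|\ge k$ there is at least one edge of $G$ directed from a vertex of $A$ to a vertex of $B$. The length of a path is its number of edges. -}

module Defs where

open import Data.Nat using (ℕ; suc; _≥_)
open import Data.Bool using (Bool; true)
open import Data.Fin using (Fin; inject₁) renaming (suc to fsuc)
open import Data.Fin.Subset using (Subset; _∈_; ∣_∣; Empty; _∩_)
open import Data.Product using (Σ; _×_; ∃; ∃-syntax)
open import Relation.Binary.PropositionalEquality using (_≡_)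
open import Relation.Nullary using (¬_)
open import Function.Definitions using (Injective)

record Digraph (n : ℕ) : Set where
  field
    edge : Fin n → Fin n → Bool

open Digraph public

Edge : ∀ {n} → Digraph n → Fin n → Fin n → Set
Edge G u v = edge G u v ≡ true

Oriented : ∀ {n} → Digraph n → Set
Oriented {n} G =
  ((v : Fin n) → ¬ Edge G v v) ×
  ((u v : Fin n) → ¬ (Edge G u v × Edge G v u))

Disjoint : ∀ {n} → Subset n → Subset n → Set
Disjoint A B = Empty (A ∩ B)

Pseudorandom : ∀ {n} → ℕ → Digraph n → Set
Pseudorandom {n} k G =
  (A B : Subset n) → Disjoint A B → ∣ A ∣ ≥ k → ∣ B ∣ ≥ k →
  ∃[ a ] ∃[ b ] (a ∈ A × b ∈ B × Edge G a b)

record DirectedPath {n} (G : Digraph n) (L : ℕ) : Set where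
  field
    vertex   : Fin (suc L) → Fin n
    distinct : Injective _≡_ _≡_ vertex
    edges    : (i : Fin L) → Edge G (vertex (inject₁ i)) (vertex (fsuc i))

module Submission where

-- A depth-first search along reversed edges keeps a set S of unvisited
-- vertices, a set T of finished vertices and an active directed path P
-- whose first vertex is the current one.  Each step either prepends an
-- unvisited in-neighbour of the current vertex to P, or, if there is none,
-- moves the current vertex to T; so |S| − |T| drops by one per step and no
-- edge ever leads from S to T.  After n steps |S| = |T|, and since S and T
-- are disjoint with no edge from S to T, pseudorandomness forces
-- |S| = |T| < k.  Hence P has at least n − 2(k − 1) vertices.

open import Data.Bool using (true)
import Data.Bool.Properties as Bool
open import Data.Empty using () renaming (⊥ to ∅)
open import Data.Fin using (Fin) renaming (zero to fzero; suc to fsuc)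
import Data.Fin.Properties as Fin
open import Data.Fin.Subset
  using (Subset; _∈_; _∉_; ∣_∣; Nonempty; ⊤; ⊥; _∪_; _-_; ⁅_⁆; inside; outside)
open import Data.Fin.Subset.Properties
  using (_∈?_; nonempty?; Empty-unique; ∉⊥; ∣⊥∣≡0; ∣⊤∣≡n; p─⊥≡p; p─q⊆p;
         ∪-identityʳ; x∈p∪q⁻; x∈⁅y⁆⇒x≡y; x∈p∩q⁻)
open import Data.Nat
  using (ℕ; zero; suc; _+_; _*_; _≤_; _<_; _≥_; _≤?_; _≤′_; ≤′-refl; ≤′-step; s≤s; z<s)
open import Data.Nat.Properties
  using (suc-injective; +-suc; +-identityʳ; +-cancelʳ-≤; +-monoʳ-≤; +-mono-≤;
         >⇒≢; ≰⇒>; ≤⇒≤′; module ≤-Reasoning)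
open import Data.Nat.Tactic.RingSolver using (solve-∀)
open import Data.Product using (∃; _,_; proj₂)
open import Data.Sum using (_⊎_; inj₁; inj₂; [_,_]′; map₂)
open import Data.Vec using (_∷_; here; there)
open import Function using (_∘_)
open import Function.Definitions using (Injective)
open import Relation.Binary.PropositionalEquality
  using (_≡_; _≢_; refl; sym; trans; cong; cong₂; subst; module ≡-Reasoning)
open import Relation.Nullary using (¬_; yes; no; contradiction)
open import Relation.Nullary.Decidable using (_×-dec_)

open import Defs

x∉p-x : ∀ {n} (p : Subset n) x → x ∉ p - x
x∉p-x (_ ∷ p) fzero      ()
x∉p-x (_ ∷ p) (fsuc x) (there x∈p-x) = x∉p-x p x x∈p-x

x∈p⇒suc∣p-x∣≡∣p∣ : ∀ {n} {p : Subset n} {x} → x ∈ p → suc ∣ p - x ∣ ≡ ∣ p ∣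
x∈p⇒suc∣p-x∣≡∣p∣ {p = inside  ∷ p} here          = cong (suc ∘ ∣_∣) (p─⊥≡p p)
x∈p⇒suc∣p-x∣≡∣p∣ {p = inside  ∷ p} (there x∈p) = cong suc (x∈p⇒suc∣p-x∣≡∣p∣ x∈p)
x∈p⇒suc∣p-x∣≡∣p∣ {p = outside ∷ p} (there x∈p) = x∈p⇒suc∣p-x∣≡∣p∣ x∈p

x∉p⇒∣p∪⁅x⁆∣≡suc∣p∣ : ∀ {n} (p : Subset n) {x} → x ∉ p → ∣ p ∪ ⁅ x ⁆ ∣ ≡ suc ∣ p ∣
x∉p⇒∣p∪⁅x⁆∣≡suc∣p∣ (inside  ∷ p) {fzero}  x∉p = contradiction here x∉p
x∉p⇒∣p∪⁅x⁆∣≡suc∣p∣ (outside ∷ p) {fzero}  x∉p = cong (suc ∘ ∣_∣) (∪-identityʳ p)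
x∉p⇒∣p∪⁅x⁆∣≡suc∣p∣ (inside  ∷ p) {fsuc x} x∉p =
  cong suc (x∉p⇒∣p∪⁅x⁆∣≡suc∣p∣ p (x∉p ∘ there))
x∉p⇒∣p∪⁅x⁆∣≡suc∣p∣ (outside ∷ p) {fsuc x} x∉p =
  x∉p⇒∣p∪⁅x⁆∣≡suc∣p∣ p (x∉p ∘ there)

0<∣p∣⇒Nonempty : ∀ {n} {p : Subset n} → 0 < ∣ p ∣ → Nonempty p
0<∣p∣⇒Nonempty {n} {p} 0<∣p∣ with nonempty? p
... | yes p≢∅ = p≢∅
... | no  p≡∅ = contradiction (trans (cong ∣_∣ (Empty-unique p≡∅)) (∣⊥∣≡0 n)) (>⇒≢ 0<∣p∣)

module _ {n : ℕ} {G : Digraph n} where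

  open DirectedPath

  singleton : Fin n → DirectedPath G 0
  singleton v = record
    { vertex   = λ _ → v
    ; distinct = λ { {fzero} {fzero} _ → refl }
    ; edges    = λ ()
    }

  tail : ∀ {L} → DirectedPath G (suc L) → DirectedPath G L
  tail P = record
    { vertex   = vertex P ∘ fsuc
    ; distinct = Fin.suc-injective ∘ distinct P
    ; edges    = edges P ∘ fsuc
    }

  shorten : ∀ {L m} → L ≤′ m → DirectedPath G m → DirectedPath G L
  shorten ≤′-refl         P = P
  shorten (≤′-step L≤′m) P = shorten L≤′m (tail P)

  prepend : ∀ {L} (P : DirectedPath G L) w → (∀ i → vertex P i ≢ w) →
            Edge G w (vertex P fzero) → DirectedPath G (suc L)
  prepend P w w∉P w→P = record
    { vertex   = vertex′
    ; distinct = distinct′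
    ; edges    = λ { fzero → w→P ; (fsuc i) → edges P i }
    }
    where
    vertex′ : Fin _ → Fin n
    vertex′ fzero    = w
    vertex′ (fsuc i) = vertex P i

    distinct′ : Injective _≡_ _≡_ vertex′
    distinct′ {fzero}  {fzero}  _  = refl
    distinct′ {fzero}  {fsuc j} eq = contradiction (sym eq) (w∉P j)
    distinct′ {fsuc i} {fzero}  eq = contradiction eq (w∉P i)
    distinct′ {fsuc i} {fsuc j} eq = cong fsuc (distinct P eq)

  data Trail : ℕ → Set where
    none : Trail 0
    path : ∀ {L} → DirectedPath G L → Trail (suc L)

  OnTrail : ∀ {m} → Trail m → Fin n → Set
  OnTrail none     x = ∅
  OnTrail (path P) x = ∃ λ i → vertex P i ≡ x

  Avoids : ∀ {m} → Trail m → Subset n → Set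
  Avoids t X = ∀ x → OnTrail t x → x ∉ X

  top : ∀ {L} → Trail (suc L) → Fin n
  top (path P) = vertex P fzero

  pop : ∀ {L} → Trail (suc L) → Trail L
  pop {zero}  (path P) = none
  pop {suc L} (path P) = path (tail P)

  pop-⊆ : ∀ {L} (t : Trail (suc L)) {x} → OnTrail (pop t) x → OnTrail t x
  pop-⊆ {suc L} (path P) (i , eq) = fsuc i , eq

  top∉pop : ∀ {L} (t : Trail (suc L)) → ¬ OnTrail (pop t) (top t)
  top∉pop {suc L} (path P) (i , eq) with distinct P eq
  ... | ()

  push : ∀ {L} (t : Trail (suc L)) w → ¬ OnTrail t w → Edge G w (top t) →
         Trail (suc (suc L))
  push (path P) w w∉P w→P = path (prepend P w (λ i eq → w∉P (i , eq)) w→P)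

  push-⊆ : ∀ {L} (t : Trail (suc L)) {w} w∉t w→t {x} →
           OnTrail (push t w w∉t w→t) x → x ≡ w ⊎ OnTrail t x
  push-⊆ (path P) _ _ (fzero  , eq) = inj₁ (sym eq)
  push-⊆ (path P) _ _ (fsuc i , eq) = inj₂ (i , eq)

  fromTrail : ∀ {L m} → L < m → Trail m → DirectedPath G L
  fromTrail (s≤s L≤m) (path P) = shorten (≤⇒≤′ L≤m) P

path-length-bound : ∀ {L k n s t m} → L + 2 * k ≡ n + 1 → s + t + m ≡ n →
                    s < k → t < k → L < m
path-length-bound {L} {k} {n} {s} {t} {m} L+2k≡n+1 s+t+m≡n s<k t<k =
  +-cancelʳ-≤ (suc s + suc t) (suc L) m (begin
    suc L + (suc s + suc t) ≤⟨ +-monoʳ-≤ (suc L) (+-mono-≤ s<k t<k) ⟩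
    suc L + (k + k)         ≡⟨ regroupˡ L k ⟩
    suc (L + 2 * k)         ≡⟨ cong suc L+2k≡n+1 ⟩
    suc (n + 1)             ≡⟨ cong (λ x → suc (x + 1)) (sym s+t+m≡n) ⟩
    suc (s + t + m + 1)     ≡⟨ regroupʳ s t m ⟩
    m + (suc s + suc t)     ∎)
  where
  open ≤-Reasoning
  regroupˡ : ∀ L k → suc L + (k + k) ≡ suc (L + 2 * k)
  regroupˡ = solve-∀
  regroupʳ : ∀ s t m → suc (s + t + m + 1) ≡ m + (suc s + suc t)
  regroupʳ = solve-∀

module DepthFirstSearch {n : ℕ} (G : Digraph n) where

  record Search (d m : ℕ) : Set where
    field
      unvisited finished : Subset n
      trail           : Trail {G = G} m
      balanced        : ∣ unvisited ∣ ≡ ∣ finished ∣ + d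
      counted         : ∣ unvisited ∣ + ∣ finished ∣ + m ≡ n
      disjoint        : ∀ x → x ∈ unvisited → x ∉ finished
      trail-unvisited : Avoids trail unvisited
      trail-finished  : Avoids trail finished
      closed          : ∀ s t → s ∈ unvisited → t ∈ finished → ¬ Edge G s t

  open Search

  initial : Search n 0
  initial = record
    { unvisited       = ⊤
    ; finished        = ⊥
    ; trail           = none
    ; balanced        = trans (∣⊤∣≡n n) (cong (_+ n) (sym (∣⊥∣≡0 n)))
    ; counted         = trans (+-identityʳ _)
                          (trans (cong₂ _+_ (∣⊤∣≡n n) (∣⊥∣≡0 n)) (+-identityʳ n))
    ; disjoint        = λ _ _ → ∉⊥
    ; trail-unvisited = λ _ ()
    ; trail-finished  = λ _ ()
    ; closed          = λ _ _ _ t∈⊥ _ → ∉⊥ t∈⊥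
    }

  visit : ∀ {d m} (σ : Search (suc d) m) {w} → w ∈ unvisited σ →
          (t : Trail (suc m)) → (∀ {x} → OnTrail t x → x ≡ w ⊎ OnTrail (trail σ) x) →
          Search d (suc m)
  visit {d} {m} σ {w} w∈S t t⊆ = record
    { unvisited       = S - w
    ; finished        = T
    ; trail           = t
    ; balanced        = suc-injective (begin
        suc ∣ S - w ∣    ≡⟨ ∣S-w∣ ⟩
        ∣ S ∣            ≡⟨ balanced σ ⟩
        ∣ T ∣ + suc d    ≡⟨ +-suc ∣ T ∣ d ⟩
        suc (∣ T ∣ + d)  ∎)
    ; counted         = begin
        ∣ S - w ∣ + ∣ T ∣ + suc m    ≡⟨ +-suc (∣ S - w ∣ + ∣ T ∣) m ⟩
        suc ∣ S - w ∣ + ∣ T ∣ + m    ≡⟨ cong (λ s → s + ∣ T ∣ + m) ∣S-w∣ ⟩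
        ∣ S ∣ + ∣ T ∣ + m            ≡⟨ counted σ ⟩
        n                            ∎
    ; disjoint        = λ x → disjoint σ x ∘ S-w⊆S
    ; trail-unvisited = λ x x∈t → [ (λ { refl → x∉p-x S w })
                                  , (λ x∈P → trail-unvisited σ x x∈P ∘ S-w⊆S) ]′ (t⊆ x∈t)
    ; trail-finished  = λ x x∈t → [ (λ { refl → disjoint σ w w∈S })
                                  , trail-finished σ x ]′ (t⊆ x∈t)
    ; closed          = λ s t → closed σ s t ∘ S-w⊆S
    }
    where
    open ≡-Reasoning
    S = unvisited σ
    T = finished σ
    ∣S-w∣ : suc ∣ S - w ∣ ≡ ∣ S ∣
    ∣S-w∣ = x∈p⇒suc∣p-x∣≡∣p∣ w∈S
    S-w⊆S : ∀ {x} → x ∈ S - w → x ∈ S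
    S-w⊆S = p─q⊆p S ⁅ w ⁆

  start : ∀ {d} → Search (suc d) 0 → Search d 1
  start σ with 0<∣p∣⇒Nonempty (subst (0 <_) (sym (trans (balanced σ) (+-suc _ _))) z<s)
  ... | v , v∈S = visit σ v∈S (path (singleton v)) (λ (_ , eq) → inj₁ (sym eq))

  extend : ∀ {d L} (σ : Search (suc d) (suc L)) {w} → w ∈ unvisited σ →
           Edge G w (top (trail σ)) → Search d (suc (suc L))
  extend σ w∈S w→top = visit σ w∈S (push (trail σ) _ w∉P w→top) (push-⊆ (trail σ) w∉P w→top)
    where w∉P = λ w∈P → trail-unvisited σ _ w∈P w∈S

  retreat : ∀ {d L} (σ : Search (suc d) (suc L)) →
            (∀ w → w ∈ unvisited σ → ¬ Edge G w (top (trail σ))) → Search d L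
  retreat {d} {L} σ stuck = record
    { unvisited       = S
    ; finished        = T ∪ ⁅ u ⁆
    ; trail           = pop (trail σ)
    ; balanced        = begin
        ∣ S ∣                ≡⟨ balanced σ ⟩
        ∣ T ∣ + suc d        ≡⟨ +-suc ∣ T ∣ d ⟩
        suc ∣ T ∣ + d        ≡⟨ cong (_+ d) (sym ∣T∪u∣) ⟩
        ∣ T ∪ ⁅ u ⁆ ∣ + d    ∎
    ; counted         = begin
        ∣ S ∣ + ∣ T ∪ ⁅ u ⁆ ∣ + L  ≡⟨ cong (λ t → ∣ S ∣ + t + L) ∣T∪u∣ ⟩
        ∣ S ∣ + suc ∣ T ∣ + L      ≡⟨ cong (_+ L) (+-suc ∣ S ∣ ∣ T ∣) ⟩
        suc (∣ S ∣ + ∣ T ∣) + L    ≡⟨ +-suc (∣ S ∣ + ∣ T ∣) L ⟨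
        ∣ S ∣ + ∣ T ∣ + suc L      ≡⟨ counted σ ⟩
        n                          ∎
    ; disjoint        = λ x x∈S → [ disjoint σ x x∈S
                                  , (λ { refl → trail-unvisited σ u (top∈trail (trail σ)) x∈S }) ]′
                                  ∘ T∪u⊆
    ; trail-unvisited = λ x → trail-unvisited σ x ∘ pop-⊆ (trail σ)
    ; trail-finished  = λ x x∈t → [ trail-finished σ x (pop-⊆ (trail σ) x∈t)
                                  , (λ { refl → top∉pop (trail σ) x∈t }) ]′
                                  ∘ T∪u⊆
    ; closed          = λ s t s∈S → [ closed σ s t s∈S , (λ { refl → stuck s s∈S }) ]′ ∘ T∪u⊆
    }
    where
    open ≡-Reasoning
    S = unvisited σ
    T = finished σ
    u = top (trail σ)
    top∈trail : ∀ {L} (t : Trail (suc L)) → OnTrail t (top t)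
    top∈trail (path P) = fzero , refl
    ∣T∪u∣ : ∣ T ∪ ⁅ u ⁆ ∣ ≡ suc ∣ T ∣
    ∣T∪u∣ = x∉p⇒∣p∪⁅x⁆∣≡suc∣p∣ T (trail-finished σ u (top∈trail (trail σ)))
    T∪u⊆ : ∀ {x} → x ∈ T ∪ ⁅ u ⁆ → x ∈ T ⊎ x ≡ u
    T∪u⊆ x∈ = map₂ (x∈⁅y⁆⇒x≡y u) (x∈p∪q⁻ T ⁅ u ⁆ x∈)

  step : ∀ {d m} → Search (suc d) m → ∃ (Search d)
  step {m = zero}  σ = 1 , start σ
  step {m = suc L} σ
    with Fin.any? (λ w → (w ∈? unvisited σ) ×-dec (edge G w (top (trail σ)) Bool.≟ true))
  ... | yes (w , w∈S , w→top) = suc (suc L) , extend σ w∈S w→top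
  ... | no ∄w                 = L , retreat σ (λ w w∈S w→top → ∄w (w , w∈S , w→top))

  run : ∀ d {m} → Search d m → ∃ (Search 0)
  run zero    σ = _ , σ
  run (suc d) σ = run d (proj₂ (step σ))

  ∣unvisited∣≡∣finished∣ : ∀ {m} (σ : Search 0 m) → ∣ unvisited σ ∣ ≡ ∣ finished σ ∣
  ∣unvisited∣≡∣finished∣ σ = trans (balanced σ) (+-identityʳ _)

  unvisited<k : ∀ {k m} → Pseudorandom k G → (σ : Search 0 m) → ∣ unvisited σ ∣ < k
  unvisited<k {k} pseudorandom σ with k ≤? ∣ unvisited σ ∣
  ... | no  k≰∣S∣ = ≰⇒> k≰∣S∣
  ... | yes k≤∣S∣ = contradiction
    (pseudorandom (unvisited σ) (finished σ) S∩T≡∅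
                  k≤∣S∣ (subst (k ≤_) (∣unvisited∣≡∣finished∣ σ) k≤∣S∣))
    (λ (s , t , s∈S , t∈T , s→t) → closed σ s t s∈S t∈T s→t)
    where
    S∩T≡∅ : Disjoint (unvisited σ) (finished σ)
    S∩T≡∅ (x , x∈S∩T) = let (x∈S , x∈T) = x∈p∩q⁻ _ _ x∈S∩T in disjoint σ x x∈S x∈T

  longPath : ∀ {k m} → Pseudorandom k G → (L : ℕ) → L + 2 * k ≡ n + 1 →
             Search 0 m → DirectedPath G L
  longPath pseudorandom L L+2k≡n+1 σ = fromTrail L<m (trail σ)
    where
    ∣S∣<k = unvisited<k pseudorandom σ
    ∣T∣<k = subst (_< _) (∣unvisited∣≡∣finished∣ σ) ∣S∣<k
    L<m   = path-length-bound L+2k≡n+1 (counted σ) ∣S∣<k ∣T∣<k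

lemma4p4 : (k n : ℕ) → k ≥ 1 → (G : Digraph n) → Oriented G →
    Pseudorandom k G → (L : ℕ) → L + 2 * k ≡ n + 1 → DirectedPath G L
lemma4p4 k n _ G _ pseudorandom L L+2k≡n+1 =
  longPath pseudorandom L L+2k≡n+1 (proj₂ (run n initial))
  where open DepthFirstSearch G
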